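{- For every integer $d\ge1$ and every finite multiset $M=\{1^{a_1},2^{a_2},\dots\}$ of positive integers, $$\frac{1}{d!}\,n\,n_{(1)}\cdots n_{(d-1)}\le e_d(M)\le n\,n_{(1)}\cdots n_{(d-1)}.$$
   Context: $n=|M|=\sum_i a_i$. Let $(b_j)_{j\ge1}$ be the nonincreasing reordering of $(a_i)_{i\ge1}$ and $n_{(j)}=n-b_1-\dots-b_j$. $e_d(M)=\sum_{j_1<\dots<j_d}a_{j_1}\cdots a_{j_d}$. -}

module Defs where

open import Data.Nat using (ℕ; zero; suc; _+_; _*_; _∸_)
open import Data.List using (List; []; _∷_; map; take; upTo)
open import Data.Nat.ListAction using (sum; product)

-- Elementary symmetric polynomial e_d(a_1,…,a_k) = Σ_{j1<…<jd} a_{j1}⋯a_{jd}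
e : ℕ → List ℕ → ℕ
e zero    _        = 1
e (suc d) []       = 0
e (suc d) (x ∷ xs) = x * e d xs + e (suc d) xs

-- n_(j) = n - b_1 - … - b_j  (b padded with zeros beyond its length)
nPart : ℕ → List ℕ → ℕ → ℕ
nPart n b j = n ∸ sum (take j b)

prodN : ℕ → List ℕ → ℕ → ℕ
prodN n b d = product (map (nPart n b) (upTo d))

-- Write P n b d = n (n − b₁) (n − b₁ − b₂) ⋯ (d factors), so that the right-hand side is
-- P |b| b d. Peeling off the first element x of a list with sum x + m, both sides obey a
-- Pascal-type recursion: e_{d+1}(x ∷ xs) = x e_d(xs) + e_{d+1}(xs) and
-- P (x + m) (x ∷ xs) (d+1) = (x + m) P m xs d, while m P m xs d ≥ P m xs (d+1).
-- This gives the upper bound by induction, for any ordering of the list. For the lower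
-- bound the list is decreasing, so the first d elements of xs are at most x and
-- m P m xs d ≤ d x P m xs d + P m xs (d+1); induction then yields the factor 1 + d of
-- (d+1)! = (1 + d) d!.
module Submission where

open import Defs
open import Data.Nat using (ℕ; zero; suc; _+_; _*_; _∸_; _≤_; _≥_; _!; z≤n)
open import Data.Nat.Properties
open import Data.Nat.ListAction using (sum; product)
open import Data.Nat.ListAction.Properties using (sum-↭)
open import Data.Nat.Tactic.RingSolver using (solve-∀)
open import Data.List using (List; []; _∷_; take; drop; applyUpTo)
open import Data.List.Properties using (map-upTo)
open import Data.List.Relation.Binary.Permutation.Propositional using (_↭_; refl; prep; swap; trans; ↭-sym)
open import Data.List.Relation.Unary.All using (All; []; _∷_)
open import Data.List.Relation.Unary.Linked as Linked using (Linked)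
open import Data.List.Relation.Unary.Linked.Properties using (Linked⇒All)
open import Data.Product using (_×_; _,_)
open import Function using (flip)
open import Relation.Binary.PropositionalEquality using (_≡_; cong; cong₂; sym; module ≡-Reasoning)
  renaming (refl to ≡-refl; trans to ≡-trans)

remainderProduct : ℕ → List ℕ → ℕ → ℕ
remainderProduct n b zero    = 1
remainderProduct n b (suc d) = n * remainderProduct (nPart n b 1) (drop 1 b) d

nPart-suc : ∀ n b j → nPart n b (suc j) ≡ nPart (nPart n b 1) (drop 1 b) j
nPart-suc n []      zero    = ≡-refl
nPart-suc n []      (suc j) = ≡-refl
nPart-suc n (x ∷ b) j rewrite +-identityʳ x = sym (∸-+-assoc n x (sum (take j b)))

product-applyUpTo-nPart : ∀ d n b (f : ℕ → ℕ) → (∀ j → f j ≡ nPart n b j) →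
                          product (applyUpTo f d) ≡ remainderProduct n b d
product-applyUpTo-nPart zero    n b f f≗ = ≡-refl
product-applyUpTo-nPart (suc d) n b f f≗ =
  cong₂ _*_ (f≗ 0) (product-applyUpTo-nPart d (nPart n b 1) (drop 1 b) (λ j → f (suc j))
                      (λ j → ≡-trans (f≗ (suc j)) (nPart-suc n b j)))

prodN≡remainderProduct : ∀ n b d → prodN n b d ≡ remainderProduct n b d
prodN≡remainderProduct n b d =
  ≡-trans (cong product (map-upTo (nPart n b) d)) (product-applyUpTo-nPart d n b (nPart n b) (λ _ → ≡-refl))

remainderProduct-∷ : ∀ x m xs d → remainderProduct (x + m) (x ∷ xs) (suc d) ≡ (x + m) * remainderProduct m xs d
remainderProduct-∷ x m xs d rewrite +-identityʳ x | m+n∸m≡n x m = ≡-refl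

remainderProduct-suc : ∀ n b d → remainderProduct n b (suc d) ≡ remainderProduct n b d * nPart n b d
remainderProduct-suc n b zero    = *-comm n 1
remainderProduct-suc n b (suc d) = begin
  n * remainderProduct n′ b′ (suc d)          ≡⟨ cong (n *_) (remainderProduct-suc n′ b′ d) ⟩
  n * (remainderProduct n′ b′ d * nPart n′ b′ d) ≡⟨ *-assoc n _ _ ⟨
  n * remainderProduct n′ b′ d * nPart n′ b′ d   ≡⟨ cong (n * remainderProduct n′ b′ d *_) (nPart-suc n b d) ⟨
  n * remainderProduct n′ b′ d * nPart n b (suc d) ∎
  where
  open ≡-Reasoning
  n′ = nPart n b 1
  b′ = drop 1 b

remainderProduct-suc≤ : ∀ n b d → remainderProduct n b (suc d) ≤ n * remainderProduct n b d
remainderProduct-suc≤ n b d rewrite remainderProduct-suc n b d | *-comm n (remainderProduct n b d) =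
  *-monoʳ-≤ (remainderProduct n b d) (m∸n≤m n (sum (take d b)))

e-swap : ∀ d x y xs → e d (x ∷ y ∷ xs) ≡ e d (y ∷ x ∷ xs)
e-swap zero          x y xs = ≡-refl
e-swap (suc zero)    x y xs = swap₁ x y (e 1 xs)
  where
  swap₁ : ∀ x y c → x * 1 + (y * 1 + c) ≡ y * 1 + (x * 1 + c)
  swap₁ = solve-∀
e-swap (suc (suc d)) x y xs = swap₂ x y (e d xs) (e (suc d) xs) (e (suc (suc d)) xs)
  where
  swap₂ : ∀ x y a b c → x * (y * a + b) + (y * b + c) ≡ y * (x * a + b) + (x * b + c)
  swap₂ = solve-∀

e-∷-cong : ∀ x {a b} → (∀ d → e d a ≡ e d b) → ∀ d → e d (x ∷ a) ≡ e d (x ∷ b)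
e-∷-cong x eq zero    = ≡-refl
e-∷-cong x eq (suc d) = cong₂ (λ u v → x * u + v) (eq d) (eq (suc d))

e-↭ : ∀ {a b} → a ↭ b → ∀ d → e d a ≡ e d b
e-↭ refl          d = ≡-refl
e-↭ (prep x p)      = e-∷-cong x (e-↭ p)
e-↭ (swap x y p)  d = ≡-trans (e-swap d x y _) (e-∷-cong y (e-∷-cong x (e-↭ p)) d)
e-↭ (trans p q)   d = ≡-trans (e-↭ p d) (e-↭ q d)

e≤remainderProduct : ∀ d a → e d a ≤ remainderProduct (sum a) a d
e≤remainderProduct zero    a        = ≤-refl
e≤remainderProduct (suc d) []       = z≤n
e≤remainderProduct (suc d) (x ∷ xs) = begin
  x * e d xs + e (suc d) xs                 ≤⟨ +-mono-≤ (*-monoʳ-≤ x (e≤remainderProduct d xs))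
                                                         (e≤remainderProduct (suc d) xs) ⟩
  x * P d + remainderProduct m xs (suc d)   ≤⟨ +-monoʳ-≤ (x * P d) (remainderProduct-suc≤ m xs d) ⟩
  x * P d + m * P d                         ≡⟨ *-distribʳ-+ (P d) x m ⟨
  (x + m) * P d                             ≡⟨ remainderProduct-∷ x m xs d ⟨
  remainderProduct (x + m) (x ∷ xs) (suc d) ∎
  where
  open ≤-Reasoning
  m = sum xs
  P = remainderProduct m xs

sum-take≤ : ∀ {x} d xs → All (_≤ x) xs → sum (take d xs) ≤ d * x
sum-take≤ zero    xs       _          = z≤n
sum-take≤ (suc d) []       _          = z≤n
sum-take≤ (suc d) (y ∷ ys) (y≤x ∷ p) = +-mono-≤ y≤x (sum-take≤ d ys p)

remainderProduct-split : ∀ x d xs → All (_≤ x) xs →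
  let m = sum xs in
  m * remainderProduct m xs d ≤ d * x * remainderProduct m xs d + remainderProduct m xs (suc d)
remainderProduct-split x d xs xs≤x = begin
  m * P                          ≤⟨ *-monoˡ-≤ P (m≤n+m∸n m s) ⟩
  (s + (m ∸ s)) * P              ≤⟨ *-monoˡ-≤ P (+-monoˡ-≤ (m ∸ s) (sum-take≤ d xs xs≤x)) ⟩
  (d * x + (m ∸ s)) * P          ≡⟨ *-distribʳ-+ P (d * x) (m ∸ s) ⟩
  d * x * P + (m ∸ s) * P        ≡⟨ cong (d * x * P +_) (*-comm (m ∸ s) P) ⟩
  d * x * P + P * nPart m xs d   ≡⟨ cong (d * x * P +_) (remainderProduct-suc m xs d) ⟨
  d * x * P + remainderProduct m xs (suc d) ∎
  where
  open ≤-Reasoning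
  m = sum xs
  s = sum (take d xs)
  P = remainderProduct m xs d

Linked-head-bounds : ∀ {x xs} → Linked _≥_ (x ∷ xs) → All (_≤ x) xs
Linked-head-bounds Linked.[-]       = []
Linked-head-bounds (x≥y Linked.∷ l) = Linked⇒All (flip ≤-trans) x≥y l

remainderProduct≤!*e : ∀ d b → Linked _≥_ b → remainderProduct (sum b) b d ≤ (d !) * e d b
remainderProduct≤!*e zero    b        _  = ≤-refl
remainderProduct≤!*e (suc d) []       _  = z≤n
remainderProduct≤!*e (suc d) (x ∷ xs) lk = begin
  remainderProduct (x + m) (x ∷ xs) (suc d)
    ≡⟨ remainderProduct-∷ x m xs d ⟩
  (x + m) * P d
    ≡⟨ *-distribʳ-+ (P d) x m ⟩
  x * P d + m * P d
    ≤⟨ +-monoʳ-≤ (x * P d) (remainderProduct-split x d xs (Linked-head-bounds lk)) ⟩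
  x * P d + (d * x * P d + P (suc d))
    ≤⟨ +-mono-≤ (*-monoʳ-≤ x IH) (+-mono-≤ (*-monoʳ-≤ (d * x) IH) (remainderProduct≤!*e (suc d) xs tl)) ⟩
  x * ((d !) * e d xs) + (d * x * ((d !) * e d xs) + (suc d !) * e (suc d) xs)
    ≡⟨ collect x d (d !) (e d xs) (e (suc d) xs) ⟩
  (suc d !) * (x * e d xs + e (suc d) xs) ∎
  where
  open ≤-Reasoning
  m = sum xs
  P = remainderProduct m xs
  tl = Linked.tail lk
  IH = remainderProduct≤!*e d xs tl
  collect : ∀ x d f a b → x * (f * a) + (d * x * (f * a) + (f + d * f) * b) ≡ (f + d * f) * (x * a + b)
  collect = solve-∀

lemma3p2 : (d : ℕ) → d ≥ 1 → (a b : List ℕ) → b ↭ a → Linked _≥_ b →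
    (prodN (sum a) b d ≤ (d !) * e d a) × (e d a ≤ prodN (sum a) b d)
lemma3p2 d _ a b b↭a sorted
  rewrite sum-↭ (↭-sym b↭a) | prodN≡remainderProduct (sum b) b d | e-↭ (↭-sym b↭a) d =
  remainderProduct≤!*e d b sorted , e≤remainderProduct d b
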